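{- Let $D$ be an oriented graph and $v\in V(D)$ with $N^-(v)=\{u_1,u_2,\ldots,u_k\}$. (i) If $d^-(u_1,u_2,\ldots,u_k)\rhd(4,3,3)$, then $D$ contains a copy of $\overrightarrow{S_{3,1}}$ centered at $v$. (ii) If $d^-(u_1,u_2,\ldots,u_k)\rhd(2,2)$, then $D$ contains a copy of $\overrightarrow{S_{2,1}}$ centered at $v$.
   Context: An oriented graph is a digraph obtained from a finite simple undirected graph by orienting each edge. $N^-(v)$ is the set of in-neighbors of $v$ and $d^-(u)$ the in-degree of $u$ in $D$; $d^-(u_1,\dots,u_k)$ denotes the vector $(d^-(u_1),\dots,d^-(u_k))$. For nonnegative vectors $\mathbf{x}\in\mathbb{R}^s$, $\mathbf{y}\in\mathbb{R}^t$, write $x_{[1]}\ge\cdots\ge x_{[s]}$ for the entries of $\mathbf x$ in decreasing order; $\mathbf{x}\rhd\mathbf{y}$ means $s\geq t$ and $x_{[i]}\geq y_{[i]}$ for all $1\le i\le t$. $\overrightarrow{S_{k,1}}$ centered at $v$ is the digraph with vertices $v$, $w_1,\dots,w_k$, $z_1,\dots,z_k$ and arcs $z_iw_i$, $w_iv$ ($i=1,\dots,k$); $D$ contains one centered at $v$ if it has a subgraph isomorphic to it with center mapped to $v$. -}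

module Defs where

open import Data.Bool using (Bool; true; false)
open import Data.Nat using (ℕ; _≤_)
open import Data.Fin using (Fin)
open import Data.List using (List; []; _∷_; length; map; filterᵇ)
open import Data.List.Base using (allFin)
open import Data.Product using (Σ; _×_; ∃-syntax)
open import Data.Unit using (⊤)
open import Data.Empty using (⊥)
open import Relation.Binary.PropositionalEquality using (_≡_; _≢_)
import Data.Nat.Properties as ℕP
import Relation.Binary.Properties.DecTotalOrder as DTO
import Data.List.Sort.InsertionSort as Sort

record OrientedGraph (n : ℕ) : Set where
  field
    arc        : Fin n → Fin n → Bool
    irreflexive : ∀ u → arc u u ≡ false
    asymmetric  : ∀ u v → arc u v ≡ true → arc v u ≡ false
open OrientedGraph public

inNeighbours : ∀ {n} → OrientedGraph n → Fin n → List (Fin n)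
inNeighbours {n} D v = filterᵇ (λ u → arc D u v) (allFin n)

inDegree : ∀ {n} → OrientedGraph n → Fin n → ℕ
inDegree D v = length (inNeighbours D v)

inDegreeVector : ∀ {n} → OrientedGraph n → Fin n → List ℕ
inDegreeVector D v = map (inDegree D) (inNeighbours D v)

sortDesc : List ℕ → List ℕ
sortDesc = Sort.sort (DTO.≥-decTotalOrder ℕP.≤-decTotalOrder)

Dom : List ℕ → List ℕ → Set
Dom _        []       = ⊤
Dom []       (_ ∷ _)  = ⊥
Dom (x ∷ xs) (y ∷ ys) = (y ≤ x) × Dom xs ys

-- x ▷ y : s ≥ t and x_[i] ≥ y_[i] for 1 ≤ i ≤ t
_▷_ : List ℕ → List ℕ → Set
xs ▷ ys = Dom (sortDesc xs) (sortDesc ys)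

-- D contains a copy of S⃗_{k,1} centred at v: distinct vertices v, w₁..w_k, z₁..z_k
-- with arcs z_i → w_i and w_i → v.
ContainsS : ∀ {n} → OrientedGraph n → (k : ℕ) → Fin n → Set
ContainsS {n} D k v =
  Σ (Fin k → Fin n) λ w → Σ (Fin k → Fin n) λ z →
    (∀ i j → w i ≡ w j → i ≡ j) ×
    (∀ i j → z i ≡ z j → i ≡ j) ×
    (∀ i j → w i ≢ z j) ×
    (∀ i → w i ≢ v) ×
    (∀ i → z i ≢ v) ×
    (∀ i → arc D (z i) (w i) ≡ true) ×
    (∀ i → arc D (w i) v ≡ true)

{-# OPTIONS --safe #-}
-- The z_i form a system of distinct representatives of the sets N⁻(u_i) ∖ {u_1, ..., u_k}
-- (they avoid v automatically, as D has no 2-cycles), and such a system can be chosen greedily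
-- once the u_i are ordered so that the i-th set, counting from 0, has at least k - i elements.
-- The set of u_i loses one element of N⁻(u_i) per arc u_j u_i.  Since at most one of u_i u_j
-- and u_j u_i is an arc, a vertex receiving few such arcs can always be put first, which is
-- enough for in-degrees (4,3,3) and (2,2).
module Submission where

open import Defs
open import Data.Nat using (ℕ; zero; suc; _+_; _≤_; _<_; z≤n; s≤s; s≤s⁻¹)
open import Data.Nat.Properties
  using (≤-refl; ≤-trans; ≤-reflexive; +-mono-≤; +-monoʳ-≤; m≤n+m; +-cancelʳ-≤; +-identityʳ;
         +-assoc; +-commutativeSemigroup; ≤-decTotalOrder; module ≤-Reasoning)
open import Algebra.Properties.CommutativeSemigroup +-commutativeSemigroup using (x∙yz≈y∙xz)
open import Data.Bool using (Bool; true; false; _∧_; not; T; T?)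
open import Data.Bool.Properties using (T-≡)
open import Data.Fin using (Fin; zero; suc; toℕ)
open import Data.Fin.Properties using (_≟_)
open import Data.Vec.Functional using () renaming (_∷_ to _∷ᵛ_; [] to []ᵛ)
open import Data.List using (List; []; _∷_; length; map; filterᵇ; tabulate; allFin)
open import Data.List.Relation.Unary.All as All using (All; []; _∷_)
open import Data.List.Relation.Unary.All.Properties using (all-filter)
open import Data.List.Relation.Unary.AllPairs using ([]; _∷_)
open import Data.List.Relation.Unary.Unique.Propositional using (Unique)
open import Data.List.Relation.Unary.Unique.Propositional.Properties using (filter⁺; allFin⁺)
open import Data.List.Relation.Binary.Permutation.Propositional using (_↭_; ↭-sym; ↭⇒↭ₛ)
open import Data.List.Relation.Binary.Permutation.Propositional.Properties using (↭-map-inv; All-resp-↭)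
open import Data.List.Relation.Binary.Permutation.Setoid.Properties using (Unique-resp-↭)
import Data.List.Sort.InsertionSort.Properties as InsertionSort
import Relation.Binary.Properties.DecTotalOrder as DecTotalOrder
open import Data.Empty using (⊥)
open import Data.Product using (_×_; _,_; proj₁; proj₂; ∃)
open import Function using (_∘_)
open import Function.Bundles using (Equivalence)
open import Function.Definitions using (Injective)
open import Relation.Nullary using (yes; no; does; contradiction)
open import Relation.Unary using (Decidable)
open import Relation.Binary.PropositionalEquality

⟦_⟧ : Bool → ℕ
⟦ true  ⟧ = 1
⟦ false ⟧ = 0

⟦⟧≤1 : ∀ b → ⟦ b ⟧ ≤ 1
⟦⟧≤1 true  = ≤-refl
⟦⟧≤1 false = z≤n

⟦⟧-mono : ∀ {a b} → (a ≡ true → b ≡ true) → ⟦ a ⟧ ≤ ⟦ b ⟧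
⟦⟧-mono {false} _   = z≤n
⟦⟧-mono {true}  a⇒b rewrite a⇒b refl = ≤-refl

⟦⟧≤0 : ∀ {b} → b ≡ false → ⟦ b ⟧ ≤ 0
⟦⟧≤0 refl = z≤n

count : ∀ {n} → (Fin n → Bool) → ℕ
count {zero}  P = 0
count {suc n} P = ⟦ P zero ⟧ + count (P ∘ suc)

count≤n : ∀ {n} (P : Fin n → Bool) → count P ≤ n
count≤n {zero}  P = z≤n
count≤n {suc n} P = +-mono-≤ (⟦⟧≤1 (P zero)) (count≤n (P ∘ suc))

count-mono : ∀ {n} {P Q : Fin n → Bool} → (∀ x → P x ≡ true → Q x ≡ true) → count P ≤ count Q
count-mono {zero}  P⇒Q = z≤n
count-mono {suc n} P⇒Q = +-mono-≤ (⟦⟧-mono (P⇒Q zero)) (count-mono (P⇒Q ∘ suc))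

0<count⇒∃ : ∀ {n} (P : Fin n → Bool) → 0 < count P → ∃ λ x → P x ≡ true
0<count⇒∃ {suc n} P 0<count with P zero in P0
... | true  = zero , P0
... | false with x , Px ← 0<count⇒∃ (P ∘ suc) 0<count = suc x , Px

length-filterᵇ-tabulate : ∀ {a} {A : Set a} {k} (P : A → Bool) (f : Fin k → A) →
                          length (filterᵇ P (tabulate f)) ≡ count (P ∘ f)
length-filterᵇ-tabulate {k = zero}  P f = refl
length-filterᵇ-tabulate {k = suc k} P f with P (f zero)
... | true  = cong suc (length-filterᵇ-tabulate P (f ∘ suc))
... | false = length-filterᵇ-tabulate P (f ∘ suc)

_-_ : ∀ {n} → (Fin n → Bool) → Fin n → Fin n → Bool
(P - b) x = P x ∧ not (does (x ≟ b))

-⁺ : ∀ {n} (P : Fin n → Bool) (b x : Fin n) → P x ≡ true → x ≢ b → (P - b) x ≡ true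
-⁺ P b x Px x≢b with x ≟ b
... | yes x≡b = contradiction x≡b x≢b
... | no  _   rewrite Px = refl

-⁻ : ∀ {n} (P : Fin n → Bool) (b : Fin n) {x} → (P - b) x ≡ true → P x ≡ true × x ≢ b
-⁻ P b {x} P-bx with P x | x ≟ b
-⁻ P b ()  | false | _
-⁻ P b ()  | true  | yes _
-⁻ P b _   | true  | no x≢b = refl , x≢b

count-remove : ∀ {n} (P : Fin n → Bool) (b : Fin n) → count P ≤ ⟦ P b ⟧ + count (P - b)
count-remove {suc n} P zero =
  +-monoʳ-≤ ⟦ P zero ⟧ (≤-trans (count-mono (λ x Px → -⁺ P zero (suc x) Px λ ())) (m≤n+m _ _))
count-remove {suc n} P (suc b) = begin
  ⟦ P zero ⟧ + count (P ∘ suc)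
    ≤⟨ +-mono-≤ (⟦⟧-mono (λ P0 → -⁺ P (suc b) zero P0 λ ())) (count-remove (P ∘ suc) b) ⟩
  ⟦ (P - suc b) zero ⟧ + (⟦ P (suc b) ⟧ + count ((P ∘ suc) - b))
    ≡⟨ x∙yz≈y∙xz ⟦ (P - suc b) zero ⟧ ⟦ P (suc b) ⟧ _ ⟩
  ⟦ P (suc b) ⟧ + count (P - suc b)
    ∎
  where open ≤-Reasoning

_∖_ : ∀ {n k} → (Fin n → Bool) → (Fin k → Fin n) → Fin n → Bool
_∖_ {k = zero}  P w = P
_∖_ {k = suc k} P w = (P - w zero) ∖ (w ∘ suc)

∖⁻ : ∀ {n k} (P : Fin n → Bool) (w : Fin k → Fin n) {x} →
     (P ∖ w) x ≡ true → P x ≡ true × (∀ j → x ≢ w j)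
∖⁻ {k = zero}  P w Px = Px , λ ()
∖⁻ {k = suc k} P w P∖wx =
  let P-w₀x , x∉w∘suc = ∖⁻ (P - w zero) (w ∘ suc) P∖wx
      Px , x≢w₀ = -⁻ P (w zero) P-w₀x
  in  Px , λ { zero → x≢w₀ ; (suc j) → x∉w∘suc j }

count-∖ : ∀ {n k} (P : Fin n → Bool) (w : Fin k → Fin n) → count P ≤ count (P ∖ w) + count (P ∘ w)
count-∖ {k = zero}  P w = ≤-reflexive (sym (+-identityʳ (count P)))
count-∖ {k = suc k} P w = begin
  count P
    ≤⟨ count-remove P (w zero) ⟩
  ⟦ P (w zero) ⟧ + count (P - w zero)
    ≤⟨ +-monoʳ-≤ _ (count-∖ (P - w zero) (w ∘ suc)) ⟩
  ⟦ P (w zero) ⟧ + (count (P ∖ w) + count ((P - w zero) ∘ w ∘ suc))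
    ≤⟨ +-monoʳ-≤ ⟦ P (w zero) ⟧ (+-monoʳ-≤ (count (P ∖ w))
         (count-mono {Q = P ∘ w ∘ suc} λ _ → proj₁ ∘ -⁻ P (w zero))) ⟩
  ⟦ P (w zero) ⟧ + (count (P ∖ w) + count (P ∘ w ∘ suc))
    ≡⟨ x∙yz≈y∙xz ⟦ P (w zero) ⟧ (count (P ∖ w)) _ ⟩
  count (P ∖ w) + count (P ∘ w)
    ∎
  where open ≤-Reasoning

fresh-∷ᵛ-injective : ∀ {a} {A : Set a} {k} {x : A} {w : Fin k → A} →
                     Injective _≡_ _≡_ w → (∀ j → x ≢ w j) → Injective _≡_ _≡_ (x ∷ᵛ w)
fresh-∷ᵛ-injective w-inj x∉w {zero}  {zero}  _     = refl
fresh-∷ᵛ-injective w-inj x∉w {zero}  {suc j} x≡wj  = contradiction x≡wj (x∉w j)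
fresh-∷ᵛ-injective w-inj x∉w {suc i} {zero}  wi≡x  = contradiction (sym wi≡x) (x∉w i)
fresh-∷ᵛ-injective w-inj x∉w {suc i} {suc j} wi≡wj = cong suc (w-inj wi≡wj)

record DistinctRepresentatives {n k} (A : Fin k → Fin n → Bool) : Set where
  field
    rep           : Fin k → Fin n
    rep-injective : Injective _≡_ _≡_ rep
    rep∈          : ∀ i → A i (rep i) ≡ true

-- Representatives are chosen from the last index down, so A i has to avoid the k - 1 - i
-- representatives chosen before it.
greedy-representatives : ∀ {n k} (A : Fin k → Fin n → Bool) →
                         (∀ i → k ≤ toℕ i + count (A i)) → DistinctRepresentatives A
greedy-representatives {k = zero}  A _ = record { rep = λ () ; rep-injective = λ { {()} } ; rep∈ = λ () }
greedy-representatives {n} {suc k} A enough = record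
  { rep           = z₀ ∷ᵛ rep
  ; rep-injective = fresh-∷ᵛ-injective rep-injective (proj₂ (∖⁻ (A zero) rep z₀∈))
  ; rep∈          = λ { zero → proj₁ (∖⁻ (A zero) rep z₀∈) ; (suc i) → rep∈ i }
  }
  where
  open DistinctRepresentatives (greedy-representatives (A ∘ suc) (s≤s⁻¹ ∘ enough ∘ suc))
  open ≤-Reasoning
  free : 0 < count (A zero ∖ rep)
  free = +-cancelʳ-≤ k 1 _ (begin
    suc k                                         ≤⟨ enough zero ⟩
    count (A zero)                                ≤⟨ count-∖ (A zero) rep ⟩
    count (A zero ∖ rep) + count (A zero ∘ rep)   ≤⟨ +-monoʳ-≤ _ (count≤n (A zero ∘ rep)) ⟩
    count (A zero ∖ rep) + k                      ∎)
  z₀ : Fin n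
  z₀ = proj₁ (0<count⇒∃ (A zero ∖ rep) free)
  z₀∈ : (A zero ∖ rep) z₀ ≡ true
  z₀∈ = proj₂ (0<count⇒∃ (A zero ∖ rep) free)

sortDesc-map : ∀ {a} {A : Set a} (f : A → ℕ) (xs : List A) →
               ∃ λ ys → sortDesc (map f xs) ≡ map f ys × xs ↭ ys
sortDesc-map f xs = ↭-map-inv f (↭-sym (InsertionSort.sort-↭ ≥-decTotalOrder (map f xs)))
  where open DecTotalOrder ≤-decTotalOrder using (≥-decTotalOrder)

module _ {n} (D : OrientedGraph n) where

  inDegree≡count : ∀ u → inDegree D u ≡ count (λ x → arc D x u)
  inDegree≡count u = length-filterᵇ-tabulate (λ x → arc D x u) (λ x → x)

  arc⇒≢ : ∀ {x y} → arc D x y ≡ true → x ≢ y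
  arc⇒≢ {x} x→y refl with () ← trans (sym x→y) (irreflexive D x)

  no-2-cycle : ∀ {x y} → arc D x y ≡ true → arc D y x ≡ true → ⊥
  no-2-cycle {x} {y} x→y y→x with () ← trans (sym y→x) (asymmetric D x y x→y)

  containsS-greedy : ∀ {k} (v : Fin n) (w : Fin k → Fin n) → Injective _≡_ _≡_ w →
    (∀ i → arc D (w i) v ≡ true) →
    (∀ i → k + count (λ j → arc D (w j) (w i)) ≤ toℕ i + inDegree D (w i)) →
    ContainsS D k v
  containsS-greedy {k} v w w-inj w→v budget =
    w , rep , (λ _ _ → w-inj) , (λ _ _ → rep-injective) ,
    (λ i j wi≡repj → proj₂ (candidate⁻ j (rep∈ j)) i (sym wi≡repj)) ,
    (λ i → arc⇒≢ (w→v i)) ,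
    (λ { i refl → no-2-cycle (w→v i) (proj₁ (candidate⁻ i (rep∈ i))) }) ,
    (λ i → proj₁ (candidate⁻ i (rep∈ i))) ,
    w→v
    where
    candidates : Fin k → Fin n → Bool
    candidates i = (λ x → arc D x (w i)) ∖ w
    candidate⁻ : ∀ i {x} → candidates i x ≡ true → arc D x (w i) ≡ true × (∀ j → x ≢ w j)
    candidate⁻ i = ∖⁻ (λ x → arc D x (w i)) w
    enough : ∀ i → k ≤ toℕ i + count (candidates i)
    enough i = +-cancelʳ-≤ c k (toℕ i + count (candidates i)) (begin
      k + c                                  ≤⟨ budget i ⟩
      toℕ i + inDegree D (w i)               ≡⟨ cong (toℕ i +_) (inDegree≡count (w i)) ⟩
      toℕ i + count (λ x → arc D x (w i))    ≤⟨ +-monoʳ-≤ (toℕ i) (count-∖ (λ x → arc D x (w i)) w) ⟩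
      toℕ i + (count (candidates i) + c)     ≡⟨ sym (+-assoc (toℕ i) _ c) ⟩
      toℕ i + count (candidates i) + c       ∎)
      where
      open ≤-Reasoning
      c : ℕ
      c = count (λ j → arc D (w j) (w i))
    open DistinctRepresentatives (greedy-representatives candidates enough)

  module _ {v : Fin n} where

    S₃-greedy : ∀ {x y z} → x ≢ y → x ≢ z → y ≢ z →
      arc D x v ≡ true → arc D y v ≡ true → arc D z v ≡ true →
      3 + (⟦ arc D y x ⟧ + ⟦ arc D z x ⟧) ≤ inDegree D x →
      2 + (⟦ arc D x y ⟧ + ⟦ arc D z y ⟧) ≤ inDegree D y →
      3 ≤ inDegree D z →
      ContainsS D 3 v
    S₃-greedy {x} {y} {z} x≢y x≢z y≢z x→v y→v z→v x-budget y-budget 3≤dz =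
      containsS-greedy v w w-injective
        (λ { zero → x→v ; (suc zero) → y→v ; (suc (suc zero)) → z→v }) budget
      where
      w : Fin 3 → Fin n
      w = x ∷ᵛ y ∷ᵛ z ∷ᵛ []ᵛ
      w-injective : Injective _≡_ _≡_ w
      w-injective = fresh-∷ᵛ-injective
        (fresh-∷ᵛ-injective (fresh-∷ᵛ-injective (λ { {()} }) λ ()) λ { zero → y≢z ; (suc ()) })
        λ { zero → x≢y ; (suc zero) → x≢z ; (suc (suc ())) }
      budget : ∀ i → 3 + count (λ j → arc D (w j) (w i)) ≤ toℕ i + inDegree D (w i)
      budget zero rewrite irreflexive D x | +-identityʳ ⟦ arc D z x ⟧ = x-budget
      budget (suc zero) rewrite irreflexive D y | +-identityʳ ⟦ arc D z y ⟧ = s≤s y-budget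
      budget (suc (suc zero)) rewrite irreflexive D z | +-identityʳ ⟦ arc D y z ⟧ =
        s≤s (s≤s (≤-trans (+-monoʳ-≤ 1 (+-mono-≤ (⟦⟧≤1 (arc D x z)) (⟦⟧≤1 (arc D y z)))) 3≤dz))

    S₂-greedy : ∀ {x y} → x ≢ y → arc D x v ≡ true → arc D y v ≡ true →
      2 + ⟦ arc D y x ⟧ ≤ inDegree D x →
      2 ≤ inDegree D y →
      ContainsS D 2 v
    S₂-greedy {x} {y} x≢y x→v y→v x-budget 2≤dy =
      containsS-greedy v w w-injective (λ { zero → x→v ; (suc zero) → y→v }) budget
      where
      w : Fin 2 → Fin n
      w = x ∷ᵛ y ∷ᵛ []ᵛ
      w-injective : Injective _≡_ _≡_ w
      w-injective = fresh-∷ᵛ-injective (fresh-∷ᵛ-injective (λ { {()} }) λ ()) λ { zero → x≢y ; (suc ()) }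
      budget : ∀ i → 2 + count (λ j → arc D (w j) (w i)) ≤ toℕ i + inDegree D (w i)
      budget zero rewrite irreflexive D x | +-identityʳ ⟦ arc D y x ⟧ = x-budget
      budget (suc zero) rewrite irreflexive D y | +-identityʳ ⟦ arc D x y ⟧ =
        s≤s (≤-trans (+-monoʳ-≤ 1 (⟦⟧≤1 (arc D x y))) 2≤dy)

    S₃-of-433-u₃↛u₂ : ∀ {u₁ u₂ u₃} → u₁ ≢ u₂ → u₁ ≢ u₃ → u₂ ≢ u₃ →
      arc D u₁ v ≡ true → arc D u₂ v ≡ true → arc D u₃ v ≡ true → arc D u₃ u₂ ≡ false →
      4 ≤ inDegree D u₁ → 3 ≤ inDegree D u₂ → 3 ≤ inDegree D u₃ → ContainsS D 3 v
    S₃-of-433-u₃↛u₂ {u₁} {u₂} {u₃} u₁≢u₂ u₁≢u₃ u₂≢u₃ u₁→v u₂→v u₃→v u₃↛u₂ d₁ d₂ d₃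
      with arc D u₂ u₁ in u₂u₁
    ... | false = S₃-greedy u₁≢u₂ u₁≢u₃ u₂≢u₃ u₁→v u₂→v u₃→v
      (≤-trans (+-monoʳ-≤ 3 (+-mono-≤ (⟦⟧≤0 u₂u₁) (⟦⟧≤1 (arc D u₃ u₁)))) d₁)
      (≤-trans (+-monoʳ-≤ 2 (+-mono-≤ (⟦⟧≤1 (arc D u₁ u₂)) (⟦⟧≤0 u₃↛u₂))) d₂)
      d₃
    ... | true = S₃-greedy (≢-sym u₁≢u₂) u₂≢u₃ u₁≢u₃ u₂→v u₁→v u₃→v
      (≤-trans (+-monoʳ-≤ 3 (+-mono-≤ (⟦⟧≤0 (asymmetric D u₂ u₁ u₂u₁)) (⟦⟧≤0 u₃↛u₂))) d₂)
      (≤-trans (+-monoʳ-≤ 2 (+-mono-≤ (⟦⟧≤1 (arc D u₂ u₁)) (⟦⟧≤1 (arc D u₃ u₁)))) d₁)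
      d₃

    S₃-of-dominated : ∀ us → Unique us → All (λ u → arc D u v ≡ true) us →
      Dom (map (inDegree D) us) (4 ∷ 3 ∷ 3 ∷ []) → ContainsS D 3 v
    S₃-of-dominated (u₁ ∷ u₂ ∷ u₃ ∷ _) ((u₁≢u₂ ∷ u₁≢u₃ ∷ _) ∷ (u₂≢u₃ ∷ _) ∷ _)
                    (u₁→v ∷ u₂→v ∷ u₃→v ∷ _) (d₁ , d₂ , d₃ , _) with arc D u₃ u₂ in u₃u₂
    ... | false = S₃-of-433-u₃↛u₂ u₁≢u₂ u₁≢u₃ u₂≢u₃ u₁→v u₂→v u₃→v u₃u₂ d₁ d₂ d₃
    ... | true  = S₃-of-433-u₃↛u₂ u₁≢u₃ u₁≢u₂ (≢-sym u₂≢u₃) u₁→v u₃→v u₂→v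
                    (asymmetric D u₃ u₂ u₃u₂) d₁ d₃ d₂
    S₃-of-dominated []           _ _ ()
    S₃-of-dominated (_ ∷ [])     _ _ (_ , ())
    S₃-of-dominated (_ ∷ _ ∷ []) _ _ (_ , _ , ())

    S₂-of-dominated : ∀ us → Unique us → All (λ u → arc D u v ≡ true) us →
      Dom (map (inDegree D) us) (2 ∷ 2 ∷ []) → ContainsS D 2 v
    S₂-of-dominated (u₁ ∷ u₂ ∷ _) ((u₁≢u₂ ∷ _) ∷ _) (u₁→v ∷ u₂→v ∷ _) (d₁ , d₂ , _)
      with arc D u₂ u₁ in u₂u₁
    ... | false = S₂-greedy u₁≢u₂ u₁→v u₂→v (≤-trans (+-monoʳ-≤ 2 (⟦⟧≤0 u₂u₁)) d₁) d₂
    ... | true  = S₂-greedy (≢-sym u₁≢u₂) u₂→v u₁→v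
                    (≤-trans (+-monoʳ-≤ 2 (⟦⟧≤0 (asymmetric D u₂ u₁ u₂u₁))) d₂) d₁
    S₂-of-dominated []       _ _ ()
    S₂-of-dominated (_ ∷ []) _ _ (_ , ())

  inNeighbours-sorted : (v : Fin n) → ∃ λ us → Unique us × All (λ u → arc D u v ≡ true) us ×
                        sortDesc (inDegreeVector D v) ≡ map (inDegree D) us
  inNeighbours-sorted v
    with us , sorted , perm ← sortDesc-map (inDegree D) (inNeighbours D v)
    = us ,
      Unique-resp-↭ (setoid (Fin n)) (↭⇒↭ₛ perm) (filter⁺ into-v? (allFin⁺ n)) ,
      All-resp-↭ perm (All.map (Equivalence.to T-≡) (all-filter into-v? (allFin n))) ,
      sorted
    where
    into-v? : Decidable (λ u → T (arc D u v))
    into-v? u = T? (arc D u v)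

lemma2p3 : (n : ℕ) (D : OrientedGraph n) (v : Fin n) →
    (inDegreeVector D v ▷ (4 ∷ 3 ∷ 3 ∷ []) → ContainsS D 3 v) ×
    (inDegreeVector D v ▷ (2 ∷ 2 ∷ []) → ContainsS D 2 v)
lemma2p3 n D v with us , distinct , into-v , sorted ← inNeighbours-sorted D v =
  (S₃-of-dominated D us distinct into-v ∘ dominated (4 ∷ 3 ∷ 3 ∷ [])) ,
  (S₂-of-dominated D us distinct into-v ∘ dominated (2 ∷ 2 ∷ []))
  where
  dominated : ∀ ys → inDegreeVector D v ▷ ys → Dom (map (inDegree D) us) (sortDesc ys)
  dominated ys = subst (λ ds → Dom ds (sortDesc ys)) sorted
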